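{- Let $d\geq3$ and $n$ be positive integers, let $R=\sqrt d\,n^{\frac{d-1}{d+1}}$ and let $\lambda$ be the largest prime not exceeding $n^{\frac1{d+1}}$ (assume such a prime exists). Then for every $\mathbf a\in\mathcal N_\lambda(R)$, every nonzero vector of the lattice $L(\mathbf a)=\{\mathbf x\in\mathbb Z^d:\mathbf a\cdot\mathbf x=0\}$ has Euclidean length at least $\lambda$.
   Context: An integer point $(a_1,\ldots,a_d)\in\mathbb Z^d$ is primitive if $\gcd(a_1,\ldots,a_d)=1$. $\mathcal N(R)$ is the set of primitive points of Euclidean norm at most $R$. $\mathcal N'_\lambda(R)$ is the set of $(a_1,\ldots,a_d)\in\mathcal N(R)$ such that $\gcd(\lambda^d,a_i)=\lambda^{d-i}$ for $3\leq i\leq d$, $\gcd(a_1,a_2)=\lambda^{d-2}$, and $\sqrt{a_1^2+a_2^2}\geq\lambda^{d-1}$. $\mathcal N_\lambda(R)$ is the set of all coordinate permutations $(a_{\sigma(1)},\ldots,a_{\sigma(d)})$ of elements $(a_1,\ldots,a_d)\in\mathcal N'_\lambda(R)$, $\sigma$ a permutation of $\{1,\ldots,d\}$. -}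

module Defs where

open import Data.Nat using (ℕ; zero; suc; _+_; _*_; _∸_; _^_; _≤_)
open import Data.Nat.GCD using (gcd)
open import Data.Nat.Primality using (Prime)
open import Data.Integer as ℤ using (ℤ; ∣_∣)
open import Data.Fin using (Fin; zero; suc; toℕ)
open import Data.Fin.Permutation using (Permutation′; _⟨$⟩ʳ_)
open import Data.Product using (Σ; _×_)
open import Relation.Binary.PropositionalEquality using (_≡_)

Point : ℕ → Set
Point d = Fin d → ℤ

sumℕ : ∀ {d} → (Fin d → ℕ) → ℕ
sumℕ {zero} f = 0
sumℕ {suc d} f = f zero + sumℕ (λ i → f (suc i))

sumℤ : ∀ {d} → (Fin d → ℤ) → ℤ
sumℤ {zero} f = ℤ.+ 0
sumℤ {suc d} f = f zero ℤ.+ sumℤ (λ i → f (suc i))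

gcdVec : ∀ {d} → Point d → ℕ
gcdVec {zero} a = 0
gcdVec {suc d} a = gcd ∣ a zero ∣ (gcdVec (λ i → a (suc i)))

Primitive : ∀ {d} → Point d → Set
Primitive a = gcdVec a ≡ 1

normSq : ∀ {d} → Point d → ℕ
normSq a = sumℕ (λ i → ∣ a i ∣ * ∣ a i ∣)

dot : ∀ {d} → Point d → Point d → ℤ
dot a x = sumℤ (λ i → a i ℤ.* x i)

-- a ∈ 𝒩(R) where R = √d · n^((d-1)/(d+1)):
-- ‖a‖ ≤ R  ⇔  ‖a‖^(2(d+1)) ≤ d^(d+1) · n^(2(d-1))
InN : (d n : ℕ) → Point d → Set
InN d n a = Primitive a × (normSq a ^ (d + 1) ≤ (d ^ (d + 1)) * (n ^ (2 * (d ∸ 1))))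

-- 𝒩'_λ(R), for d = m + 2 (coordinates a₁,a₂ are indices 0,1;
-- the 1-based coordinate index i corresponds to Fin index with toℕ = i - 1)
InN' : (m n λ' : ℕ) → Point (suc (suc m)) → Set
InN' m n λ' a =
  InN d n a
  × ((i : Fin d) → 2 ≤ toℕ i → gcd (λ' ^ d) ∣ a i ∣ ≡ λ' ^ (d ∸ suc (toℕ i)))
  × (gcd ∣ a zero ∣ ∣ a (suc zero) ∣ ≡ λ' ^ (d ∸ 2))
  × (λ' ^ (2 * (d ∸ 1)) ≤ ∣ a zero ∣ * ∣ a zero ∣ + ∣ a (suc zero) ∣ * ∣ a (suc zero) ∣)
  where d = suc (suc m)

InNλ : (m n λ' : ℕ) → Point (suc (suc m)) → Set
InNλ m n λ' a = Σ (Permutation′ (suc (suc m))) λ σ → Σ (Point (suc (suc m))) λ b →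
  InN' m n λ' b × ((i : Fin (suc (suc m))) → a i ≡ b (σ ⟨$⟩ʳ i))

-- λ is the largest prime not exceeding n^(1/(d+1)):  p ≤ n^(1/(d+1)) ⇔ p^(d+1) ≤ n
LargestPrimeRoot : (d n λ' : ℕ) → Set
LargestPrimeRoot d n λ' = Prime λ' × (λ' ^ (d + 1) ≤ n)
  × ((p : ℕ) → Prime p → p ^ (d + 1) ≤ n → p ≤ λ')

-- Permuting coordinates preserves both the lattice and the norm, so we may take a ∈ 𝒩'_λ(R).
-- If some |x_i| ≥ λ there is nothing to prove, so let all |x_i| < λ. The gcd conditions make
-- λ^(d-j) divide every a_i with i < j, so by descending induction on j ≥ 3 the relation a · x = 0
-- gives λ ∣ x_j, i.e. x_j = 0. What remains is a₁x₁ + a₂x₂ = 0 with gcd(a₁, a₂) = λ^(d-2): every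
-- nonzero solution is a multiple of (a₂, -a₁)/λ^(d-2), of squared length at least
-- λ^(2(d-1)) / λ^(2(d-2)) = λ².
module Submission where

open import Defs
open import Data.Nat using (ℕ; suc; _≤_; _*_)
open import Data.Integer using (ℤ)
open import Data.Fin using (Fin)
open import Data.Product using (Σ; _×_)
open import Relation.Binary.PropositionalEquality using (_≡_; _≢_)

open import Function using (_∘_)
open import Data.Nat using (zero; _+_; _∸_; _^_; _<_; z≤n; s≤s; NonZero; NonTrivial; nonTrivial⇒n>1; _≤?_)
open import Data.Nat.Properties
open import Data.Nat.Divisibility using (_∣_; divides; ∣-trans; m∣m*n; _∣0; >⇒∤; *-cancelˡ-∣; *-monoˡ-∣; ∣⇒≤)
open import Data.Nat.DivMod using (_/_; m/n*n≡m)
open import Data.Nat.GCD using (gcd; gcd[m,n]∣m; gcd[m,n]∣n; gcd-greatest)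
open import Data.Nat.Coprimality as Coprime using (Coprime; coprime-divisor; coprime-/gcd)
open import Data.Nat.Primality using (Prime; euclidsLemma; prime⇒nonZero; prime⇒nonTrivial)
open import Data.Integer as ℤ using (+_; ∣_∣)
import Data.Integer.Properties as ℤ
import Data.Integer.Divisibility.Signed as ℤ
open import Data.Fin using (zero; suc; toℕ; punchIn)
open import Data.Fin.Properties using (toℕ<n; toℕ-injective; punchInᵢ≢i)
open import Data.Fin.Permutation using (Permutation′; _⟨$⟩ʳ_; _⟨$⟩ˡ_; inverseˡ)
open import Data.Product using (_,_)
open import Data.Sum using (_⊎_; inj₁; inj₂)
open import Relation.Nullary using (¬_; yes; no; contradiction)
open import Relation.Binary.Definitions using (tri<; tri≈; tri>)
open import Relation.Binary.PropositionalEquality using (refl; sym; trans; cong; cong₂; subst; subst₂; _≗_; module ≡-Reasoning)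
open import Data.Nat.Solver using (module +-*-Solver)
import Algebra.Properties.CommutativeMonoid.Sum as CommutativeMonoidSum

module ℕΣ = CommutativeMonoidSum +-0-commutativeMonoid
module ℤΣ = CommutativeMonoidSum ℤ.+-0-commutativeMonoid

sumℕ≡sum : ∀ {k} (f : Fin k → ℕ) → sumℕ f ≡ ℕΣ.sum f
sumℕ≡sum {zero} f = refl
sumℕ≡sum {suc k} f = cong (_+_ (f zero)) (sumℕ≡sum (f ∘ suc))

sumℤ≡sum : ∀ {k} (f : Fin k → ℤ) → sumℤ f ≡ ℤΣ.sum f
sumℤ≡sum {zero} f = refl
sumℤ≡sum {suc k} f = cong (ℤ._+_ (f zero)) (sumℤ≡sum (f ∘ suc))

sumℕ-cong : ∀ {k} {f g : Fin k → ℕ} → f ≗ g → sumℕ f ≡ sumℕ g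
sumℕ-cong {f = f} {g} f≗g = trans (sumℕ≡sum f) (trans (ℕΣ.sum-cong-≗ f≗g) (sym (sumℕ≡sum g)))

sumℤ-cong : ∀ {k} {f g : Fin k → ℤ} → f ≗ g → sumℤ f ≡ sumℤ g
sumℤ-cong {f = f} {g} f≗g = trans (sumℤ≡sum f) (trans (ℤΣ.sum-cong-≗ f≗g) (sym (sumℤ≡sum g)))

sumℕ-permute : ∀ {k} (f : Fin k → ℕ) (π : Permutation′ k) → sumℕ f ≡ sumℕ (f ∘ (π ⟨$⟩ʳ_))
sumℕ-permute f π = trans (sumℕ≡sum f) (trans (ℕΣ.sum-permute f π) (sym (sumℕ≡sum (f ∘ (π ⟨$⟩ʳ_)))))

sumℤ-permute : ∀ {k} (f : Fin k → ℤ) (π : Permutation′ k) → sumℤ f ≡ sumℤ (f ∘ (π ⟨$⟩ʳ_))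
sumℤ-permute f π = trans (sumℤ≡sum f) (trans (ℤΣ.sum-permute f π) (sym (sumℤ≡sum (f ∘ (π ⟨$⟩ʳ_)))))

sumℤ-remove : ∀ {k} (f : Fin (suc k) → ℤ) (j : Fin (suc k)) → sumℤ f ≡ f j ℤ.+ sumℤ (f ∘ punchIn j)
sumℤ-remove f j = trans (sumℤ≡sum f) (trans (ℤΣ.sum-remove f) (cong (ℤ._+_ (f j)) (sym (sumℤ≡sum (f ∘ punchIn j)))))

sumℤ-≡0 : ∀ {k} (f : Fin k → ℤ) → (∀ i → f i ≡ + 0) → sumℤ f ≡ + 0
sumℤ-≡0 {zero} f _ = refl
sumℤ-≡0 {suc k} f f≡0 = cong₂ ℤ._+_ (f≡0 zero) (sumℤ-≡0 (f ∘ suc) (f≡0 ∘ suc))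

term≤sumℕ : ∀ {k} (f : Fin k → ℕ) i → f i ≤ sumℕ f
term≤sumℕ f zero = m≤m+n (f zero) _
term≤sumℕ f (suc i) = ≤-trans (term≤sumℕ (f ∘ suc) i) (m≤n+m _ (f zero))

∣-sumℤ : ∀ {k c} (f : Fin k → ℤ) → (∀ i → c ℤ.∣ f i) → c ℤ.∣ sumℤ f
∣-sumℤ {zero} {c} f _ = ℤ.∣ᵤ⇒∣ (∣ c ∣ ∣0)
∣-sumℤ {suc k} f c∣f = ℤ.∣m∣n⇒∣m+n (c∣f zero) (∣-sumℤ (f ∘ suc) (c∣f ∘ suc))

∣sumℤ⇒∣term : ∀ {k c} (f : Fin (suc k) → ℤ) (j : Fin (suc k))
  → (∀ i → i ≢ j → c ℤ.∣ f i) → c ℤ.∣ sumℤ f → c ℤ.∣ f j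
∣sumℤ⇒∣term f j c∣others c∣sum = ℤ.∣m+n∣n⇒∣m (subst (_ ℤ.∣_) (sumℤ-remove f j) c∣sum)
  (∣-sumℤ (f ∘ punchIn j) (λ i → c∣others (punchIn j i) (punchInᵢ≢i j i)))

dot-cong : ∀ {k} {a a′ x x′ : Point k} → a ≗ a′ → x ≗ x′ → dot a x ≡ dot a′ x′
dot-cong a≗a′ x≗x′ = sumℤ-cong (λ i → cong₂ ℤ._*_ (a≗a′ i) (x≗x′ i))

normSq-cong : ∀ {k} {x x′ : Point k} → x ≗ x′ → normSq x ≡ normSq x′
normSq-cong x≗x′ = sumℕ-cong (λ i → cong (λ t → ∣ t ∣ * ∣ t ∣) (x≗x′ i))

dot-permute : ∀ {k} (a x : Point k) (π : Permutation′ k) → dot a x ≡ dot (a ∘ (π ⟨$⟩ʳ_)) (x ∘ (π ⟨$⟩ʳ_))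
dot-permute a x = sumℤ-permute (λ i → a i ℤ.* x i)

normSq-permute : ∀ {k} (x : Point k) (π : Permutation′ k) → normSq x ≡ normSq (x ∘ (π ⟨$⟩ʳ_))
normSq-permute x = sumℕ-permute (λ i → ∣ x i ∣ * ∣ x i ∣)

i+j≡0⇒∣i∣≡∣j∣ : ∀ i j → i ℤ.+ j ≡ + 0 → ∣ i ∣ ≡ ∣ j ∣
i+j≡0⇒∣i∣≡∣j∣ i j i+j≡0 = trans (cong ∣_∣ i≡-j) (ℤ.∣-i∣≡∣i∣ j)
  where
  i≡-j : i ≡ ℤ.- j
  i≡-j = ℤ.i-j≡0⇒i≡j i (ℤ.- j) (trans (cong (ℤ._+_ i) (ℤ.neg-involutive j)) i+j≡0)

^-monoʳ-∣ : ∀ p {a b} → a ≤ b → p ^ a ∣ p ^ b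
^-monoʳ-∣ p {a} {b} a≤b = subst (λ t → p ^ a ∣ p ^ t) (m+[n∸m]≡n a≤b)
  (subst (p ^ a ∣_) (sym (^-distribˡ-+-* p a (b ∸ a))) (m∣m*n (p ^ (b ∸ a))))

∣∧<⇒≡0 : ∀ {p y} → p ∣ y → y < p → y ≡ 0
∣∧<⇒≡0 {y = zero} _ _ = refl
∣∧<⇒≡0 {y = suc _} p∣y y<p = contradiction p∣y (>⇒∤ y<p)

-- p ^ e is the exact power of p dividing B, so the extra factor p must come from Y.
prime-∣-cofactor : ∀ {p d e B Y} → Prime p → gcd (p ^ d) B ≡ p ^ e → e < d
  → p ^ suc e ∣ B * Y → p ∣ Y
prime-∣-cofactor {p} {d} {e} {B} {Y} p-prime gcd≡pᵉ e<d pᵉ⁺¹∣BY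
  with divides k B≡k*gcd ← gcd[m,n]∣n (p ^ d) B = p∣k⊎p∣Y⇒p∣Y (euclidsLemma k Y p-prime p∣kY)
  where
  instance
    _ : NonTrivial p
    _ = prime⇒nonTrivial p-prime
    _ : NonZero (p ^ e)
    _ = m^n≢0 p e {{prime⇒nonZero p-prime}}
  B≡k*pᵉ : B ≡ k * p ^ e
  B≡k*pᵉ = trans B≡k*gcd (cong (k *_) gcd≡pᵉ)
  p∣kY : p ∣ k * Y
  p∣kY = *-cancelˡ-∣ (p ^ e) (subst₂ _∣_ (*-comm p (p ^ e))
    (trans (cong (_* Y) (trans B≡k*pᵉ (*-comm k (p ^ e)))) (*-assoc (p ^ e) k Y)) pᵉ⁺¹∣BY)
  pᵉ⁺¹∤pᵉ : ¬ (p ^ suc e ∣ p ^ e)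
  pᵉ⁺¹∤pᵉ pᵉ⁺¹∣pᵉ = <⇒≱ (^-monoʳ-< p (nonTrivial⇒n>1 p) (n<1+n e)) (∣⇒≤ pᵉ⁺¹∣pᵉ)
  p∣k⊎p∣Y⇒p∣Y : (p ∣ k) ⊎ (p ∣ Y) → p ∣ Y
  p∣k⊎p∣Y⇒p∣Y (inj₂ p∣Y) = p∣Y
  p∣k⊎p∣Y⇒p∣Y (inj₁ p∣k) = contradiction (subst (p ^ suc e ∣_) gcd≡pᵉ
    (gcd-greatest (^-monoʳ-∣ p e<d) (subst (p ^ suc e ∣_) (sym B≡k*pᵉ) (*-monoˡ-∣ (p ^ e) p∣k)))) pᵉ⁺¹∤pᵉ

coprime-solution-≥ : ∀ {c₀ c₁ y₀ y₁} → Coprime c₀ c₁ → c₀ * y₀ ≡ c₁ * y₁ → ¬ (y₀ ≡ 0 × y₁ ≡ 0) → c₀ ≤ y₁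
coprime-solution-≥ {c₀} {c₁} {y₀} {zero} _ eq nonzero with m*n≡0⇒m≡0∨n≡0 c₀ (trans eq (*-zeroʳ c₁))
... | inj₁ c₀≡0 = ≤-reflexive c₀≡0
... | inj₂ y₀≡0 = contradiction (y₀≡0 , refl) nonzero
coprime-solution-≥ {c₀} {c₁} {y₀} {suc _} coprime eq _ =
  ∣⇒≤ (coprime-divisor coprime (divides y₀ (trans (sym eq) (*-comm c₀ y₀))))

-- Writing A = c₀ g and B = c₁ g with c₀, c₁ coprime, any nonzero solution has c₀ ≤ y₁ and c₁ ≤ y₀.
gcd-solution-bound : ∀ {A B y₀ y₁} .{{_ : NonZero (gcd A B)}} → A * y₀ ≡ B * y₁ → ¬ (y₀ ≡ 0 × y₁ ≡ 0)
  → A * A + B * B ≤ gcd A B * gcd A B * (y₀ * y₀ + y₁ * y₁)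
gcd-solution-bound {A} {B} {y₀} {y₁} Ay₀≡By₁ nonzero = begin
  A * A + B * B                          ≡⟨ cong₂ (λ a b → a * a + b * b) (sym c₀g≡A) (sym c₁g≡B) ⟩
  c₀ * g * (c₀ * g) + c₁ * g * (c₁ * g)  ≡⟨ solve 3 (λ G C D → C :* G :* (C :* G) :+ D :* G :* (D :* G)
                                                              := G :* G :* (C :* C :+ D :* D)) refl g c₀ c₁ ⟩
  g * g * (c₀ * c₀ + c₁ * c₁)            ≤⟨ *-monoʳ-≤ (g * g) (+-mono-≤ (*-mono-≤ c₀≤y₁ c₀≤y₁) (*-mono-≤ c₁≤y₀ c₁≤y₀)) ⟩
  g * g * (y₁ * y₁ + y₀ * y₀)            ≡⟨ cong (g * g *_) (+-comm (y₁ * y₁) (y₀ * y₀)) ⟩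
  g * g * (y₀ * y₀ + y₁ * y₁)            ∎
  where
  open ≤-Reasoning
  open +-*-Solver
  g c₀ c₁ : ℕ
  g = gcd A B
  c₀ = A / g
  c₁ = B / g
  c₀g≡A : c₀ * g ≡ A
  c₀g≡A = m/n*n≡m (gcd[m,n]∣m A B)
  c₁g≡B : c₁ * g ≡ B
  c₁g≡B = m/n*n≡m (gcd[m,n]∣n A B)
  g*[c*y]≡[c*g]*y : ∀ c y → g * (c * y) ≡ c * g * y
  g*[c*y]≡[c*g]*y c y = trans (sym (*-assoc g c y)) (cong (_* y) (*-comm g c))
  c₀y₀≡c₁y₁ : c₀ * y₀ ≡ c₁ * y₁
  c₀y₀≡c₁y₁ = *-cancelˡ-≡ (c₀ * y₀) (c₁ * y₁) g
    (trans (trans (g*[c*y]≡[c*g]*y c₀ y₀) (cong (_* y₀) c₀g≡A))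
    (trans Ay₀≡By₁ (sym (trans (g*[c*y]≡[c*g]*y c₁ y₁) (cong (_* y₁) c₁g≡B)))))
  c₀≤y₁ : c₀ ≤ y₁
  c₀≤y₁ = coprime-solution-≥ (coprime-/gcd A B) c₀y₀≡c₁y₁ nonzero
  c₁≤y₀ : c₁ ≤ y₀
  c₁≤y₀ = coprime-solution-≥ (Coprime.sym (coprime-/gcd A B)) (sym c₀y₀≡c₁y₁) (λ (z₁ , z₀) → nonzero (z₀ , z₁))

m^[2*[1+n]]≡m^n*m^n*[m*m] : ∀ m n → m ^ (2 * suc n) ≡ m ^ n * m ^ n * (m * m)
m^[2*[1+n]]≡m^n*m^n*[m*m] m n = begin
  m ^ (2 * suc n)          ≡⟨ cong (m ^_) (solve 1 (λ N → con 2 :* (con 1 :+ N) := (N :+ N) :+ con 2) refl n) ⟩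
  m ^ ((n + n) + 2)        ≡⟨ ^-distribˡ-+-* m (n + n) 2 ⟩
  m ^ (n + n) * m ^ 2      ≡⟨ cong₂ _*_ (^-distribˡ-+-* m n n) (cong (m *_) (*-identityʳ m)) ⟩
  m ^ n * m ^ n * (m * m)  ∎
  where
  open ≡-Reasoning
  open +-*-Solver

-- Descending induction on j ≥ 2: once all later coordinates of y vanish, every term b i y i with
-- i ≠ j of b · y is divisible by p ^ (d - j), hence so is b j y j, which forces p ∣ y j.
module TailVanishes {m p : ℕ} (p-prime : Prime p) (b y : Point (suc (suc m)))
  (gcd-tail : (i : Fin (suc (suc m))) → 2 ≤ toℕ i → gcd (p ^ suc (suc m)) ∣ b i ∣ ≡ p ^ (suc (suc m) ∸ suc (toℕ i)))
  (gcd-head : gcd ∣ b zero ∣ ∣ b (suc zero) ∣ ≡ p ^ m)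
  (b·y≡0 : dot b y ≡ + 0)
  (y-small : ∀ i → ∣ y i ∣ < p) where

  d : ℕ
  d = suc (suc m)

  pow-∣-earlier : (i j : Fin d) → 2 ≤ toℕ j → toℕ i < toℕ j → p ^ (d ∸ toℕ j) ∣ ∣ b i ∣
  pow-∣-earlier zero j 2≤j _ = ∣-trans (^-monoʳ-∣ p (∸-monoʳ-≤ d 2≤j))
    (subst (_∣ ∣ b zero ∣) gcd-head (gcd[m,n]∣m ∣ b zero ∣ ∣ b (suc zero) ∣))
  pow-∣-earlier (suc zero) j 2≤j _ = ∣-trans (^-monoʳ-∣ p (∸-monoʳ-≤ d 2≤j))
    (subst (_∣ ∣ b (suc zero) ∣) gcd-head (gcd[m,n]∣n ∣ b zero ∣ ∣ b (suc zero) ∣))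
  pow-∣-earlier i@(suc (suc _)) j _ i<j = ∣-trans (^-monoʳ-∣ p (∸-monoʳ-≤ d i<j))
    (subst (_∣ ∣ b i ∣) (gcd-tail i (s≤s (s≤s z≤n))) (gcd[m,n]∣n (p ^ d) ∣ b i ∣))

  pow-∣-other-terms : (j : Fin d) → 2 ≤ toℕ j → (∀ i → toℕ j < toℕ i → y i ≡ + 0)
    → ∀ i → i ≢ j → + (p ^ (d ∸ toℕ j)) ℤ.∣ b i ℤ.* y i
  pow-∣-other-terms j 2≤j later≡0 i i≢j with <-cmp (toℕ i) (toℕ j)
  ... | tri< i<j _ _ = ℤ.∣ᵤ⇒∣ (subst (p ^ (d ∸ toℕ j) ∣_) (sym (ℤ.abs-* (b i) (y i)))
                         (∣-trans (pow-∣-earlier i j 2≤j i<j) (m∣m*n ∣ y i ∣)))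
  ... | tri≈ _ i≡j _ = contradiction (toℕ-injective i≡j) i≢j
  ... | tri> _ _ j<i = ℤ.∣ᵤ⇒∣ (subst (λ t → p ^ (d ∸ toℕ j) ∣ ∣ b i ℤ.* t ∣) (sym (later≡0 i j<i))
                         (subst (λ t → p ^ (d ∸ toℕ j) ∣ ∣ t ∣) (sym (ℤ.*-zeroʳ (b i))) ((p ^ (d ∸ toℕ j)) ∣0)))

  coordinate≡0 : (j : Fin d) → 2 ≤ toℕ j → (∀ i → toℕ j < toℕ i → y i ≡ + 0) → y j ≡ + 0
  coordinate≡0 j 2≤j later≡0 = ℤ.∣i∣≡0⇒i≡0 (∣∧<⇒≡0 p∣yⱼ (y-small j))
    where
    p^[d∸j]∣bⱼyⱼ : + (p ^ (d ∸ toℕ j)) ℤ.∣ b j ℤ.* y j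
    p^[d∸j]∣bⱼyⱼ = ∣sumℤ⇒∣term (λ i → b i ℤ.* y i) j (pow-∣-other-terms j 2≤j later≡0)
      (subst (+ (p ^ (d ∸ toℕ j)) ℤ.∣_) (sym b·y≡0) (ℤ.∣ᵤ⇒∣ ((p ^ (d ∸ toℕ j)) ∣0)))
    p∣yⱼ : p ∣ ∣ y j ∣
    p∣yⱼ = prime-∣-cofactor p-prime (gcd-tail j 2≤j) (s≤s (m∸n≤m (suc m) (toℕ j)))
      (subst₂ (λ e t → p ^ e ∣ t) (+-∸-assoc 1 (toℕ<n j)) (ℤ.abs-* (b j) (y j)) (ℤ.∣⇒∣ᵤ p^[d∸j]∣bⱼyⱼ))

  coordinate≡0-within : ∀ k (j : Fin d) → 2 ≤ toℕ j → d ≤ toℕ j + k → y j ≡ + 0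
  coordinate≡0-within zero j _ d≤j+0 = contradiction (subst (d ≤_) (+-identityʳ (toℕ j)) d≤j+0) (<⇒≱ (toℕ<n j))
  coordinate≡0-within (suc k) j 2≤j d≤j+1+k = coordinate≡0 j 2≤j λ i j<i →
    coordinate≡0-within k i (≤-trans 2≤j (<⇒≤ j<i))
      (≤-trans d≤j+1+k (≤-trans (≤-reflexive (+-suc (toℕ j) k)) (+-monoˡ-≤ k j<i)))

  tail≡0 : ∀ j → 2 ≤ toℕ j → y j ≡ + 0
  tail≡0 j 2≤j = coordinate≡0-within d j 2≤j (m≤n+m d (toℕ j))

  head-equation : ∣ b zero ∣ * ∣ y zero ∣ ≡ ∣ b (suc zero) ∣ * ∣ y (suc zero) ∣
  head-equation = trans (sym (ℤ.abs-* (b zero) (y zero)))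
    (trans (i+j≡0⇒∣i∣≡∣j∣ (b zero ℤ.* y zero) (b (suc zero) ℤ.* y (suc zero)) head-sum≡0) (ℤ.abs-* (b (suc zero)) (y (suc zero))))
    where
    tail-sum≡0 : sumℤ (λ i → b (suc (suc i)) ℤ.* y (suc (suc i))) ≡ + 0
    tail-sum≡0 = sumℤ-≡0 _ (λ i → trans (cong (ℤ._*_ (b (suc (suc i)))) (tail≡0 (suc (suc i)) (s≤s (s≤s z≤n))))
                                        (ℤ.*-zeroʳ (b (suc (suc i)))))
    head-sum≡0 : b zero ℤ.* y zero ℤ.+ b (suc zero) ℤ.* y (suc zero) ≡ + 0
    head-sum≡0 = trans (cong (ℤ._+_ (b zero ℤ.* y zero))
      (sym (trans (cong (ℤ._+_ (b (suc zero) ℤ.* y (suc zero))) tail-sum≡0) (ℤ.+-identityʳ _)))) b·y≡0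

InN′⇒λ²≤normSq : ∀ {m n p} {b : Point (suc (suc m))} → Prime p → InN' m n p b
  → (y : Point (suc (suc m))) → dot b y ≡ + 0 → Σ (Fin (suc (suc m))) (λ i → y i ≢ + 0) → p * p ≤ normSq y
InN′⇒λ²≤normSq {m} {p = p} {b} p-prime (_ , gcd-tail , gcd-head , head-large) y b·y≡0 (w , y-w≢0)
  with p * p ≤? normSq y
... | yes p²≤normSq = p²≤normSq
... | no p²≰normSq = ≤-trans (*-cancelˡ-≤ (p ^ m * p ^ m) p²-scaled) (+-monoʳ-≤ (Y₀ * Y₀) (m≤m+n (Y₁ * Y₁) _))
  where
  y-small : ∀ i → ∣ y i ∣ < p
  y-small i = ≰⇒> (λ p≤yᵢ → p²≰normSq (≤-trans (*-mono-≤ p≤yᵢ p≤yᵢ) (term≤sumℕ (λ i → ∣ y i ∣ * ∣ y i ∣) i)))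
  open TailVanishes p-prime b y gcd-tail gcd-head b·y≡0 y-small
  A B Y₀ Y₁ : ℕ
  A = ∣ b zero ∣
  B = ∣ b (suc zero) ∣
  Y₀ = ∣ y zero ∣
  Y₁ = ∣ y (suc zero) ∣
  head≢0 : ¬ (Y₀ ≡ 0 × Y₁ ≡ 0)
  head≢0 (Y₀≡0 , Y₁≡0) = y-w≢0 (y≡0 w)
    where
    y≡0 : ∀ i → y i ≡ + 0
    y≡0 zero = ℤ.∣i∣≡0⇒i≡0 Y₀≡0
    y≡0 (suc zero) = ℤ.∣i∣≡0⇒i≡0 Y₁≡0
    y≡0 i@(suc (suc _)) = tail≡0 i (s≤s (s≤s z≤n))
  instance
    _ : NonZero (p ^ m)
    _ = m^n≢0 p m {{prime⇒nonZero p-prime}}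
    _ : NonZero (p ^ m * p ^ m)
    _ = m*n≢0 (p ^ m) (p ^ m)
    _ : NonZero (gcd A B)
    _ = subst NonZero (sym gcd-head) (m^n≢0 p m {{prime⇒nonZero p-prime}})
  p²-scaled : p ^ m * p ^ m * (p * p) ≤ p ^ m * p ^ m * (Y₀ * Y₀ + Y₁ * Y₁)
  p²-scaled = begin
    p ^ m * p ^ m * (p * p)                ≡⟨ sym (m^[2*[1+n]]≡m^n*m^n*[m*m] p m) ⟩
    p ^ (2 * suc m)                        ≤⟨ head-large ⟩
    A * A + B * B                          ≤⟨ gcd-solution-bound {A} {B} head-equation head≢0 ⟩
    gcd A B * gcd A B * (Y₀ * Y₀ + Y₁ * Y₁) ≡⟨ cong (λ g → g * g * (Y₀ * Y₀ + Y₁ * Y₁)) gcd-head ⟩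
    p ^ m * p ^ m * (Y₀ * Y₀ + Y₁ * Y₁)    ∎
    where open ≤-Reasoning

lemma6 : (m n λ' : ℕ) → 1 ≤ m → 1 ≤ n → LargestPrimeRoot (suc (suc m)) n λ'
    → (a : Point (suc (suc m))) → InNλ m n λ' a
    → (x : Point (suc (suc m))) → dot a x ≡ Data.Integer.+ 0 → Σ (Fin (suc (suc m))) (λ i → x i ≢ Data.Integer.+ 0)
    → λ' * λ' ≤ normSq x
lemma6 m n λ' _ _ (λ'-prime , _) a (σ , b , b∈N' , a≗b∘σ) x a·x≡0 (i , xᵢ≢0) =
  subst (λ' * λ' ≤_) (sym normSq-x≡normSq-y) (InN′⇒λ²≤normSq {n = n} {b = b} λ'-prime b∈N' y b·y≡0 (σ ⟨$⟩ʳ i , yσᵢ≢0))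
  where
  y : Point (suc (suc m))
  y = x ∘ (σ ⟨$⟩ˡ_)
  x≗y∘σ : x ≗ y ∘ (σ ⟨$⟩ʳ_)
  x≗y∘σ j = cong x (sym (inverseˡ σ))
  yσᵢ≢0 : y (σ ⟨$⟩ʳ i) ≢ + 0
  yσᵢ≢0 = xᵢ≢0 ∘ trans (x≗y∘σ i)
  b·y≡0 : dot b y ≡ + 0
  b·y≡0 = trans (dot-permute b y σ) (trans (dot-cong (sym ∘ a≗b∘σ) (sym ∘ x≗y∘σ)) a·x≡0)
  normSq-x≡normSq-y : normSq x ≡ normSq y
  normSq-x≡normSq-y = trans (normSq-cong x≗y∘σ) (sym (normSq-permute y σ))
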